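{- Let $k$ be a positive integer and let $\Sigma$ be an alphabet with $k$ letters. Let $n\in\mathbb N$ and let $\varphi \in \mathrm{FO}^2_n[<]$ be a sentence over $\Sigma$. If $\varphi$ is satisfiable (by some word in $\Sigma^\star$), then $\varphi$ has a model $w\in\Sigma^\star$ of length $O(n^k)$, where the implied constant depends only on $k$.
   Context: A word $w=w_1\cdots w_{|w|}\in\Sigma^\star$ is identified with the structure with universe $\{1,\dots,|w|\}$, linear order $<$, and unary relations $Q_{\mathtt a}=\{i:w_i=\mathtt a\}$, $\mathtt a\in\Sigma$. $\mathrm{FO}^2_n[<]$ is the set of first-order formulas over this vocabulary using only the variables $x,y$ (which may be requantified) with quantifier depth at most $n$. -}

module Defs where

open import Data.Nat using (ℕ; zero; suc; _⊔_; _<ᵇ_; _≡ᵇ_)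
open import Data.Fin using (Fin; _≟_)
open import Data.Bool using (Bool; true; false; not; _∧_; _∨_)
open import Data.List using (List; []; _∷_; length)
open import Data.Maybe using (Maybe; just; nothing)
open import Data.Empty using (⊥)
open import Data.Sum using (_⊎_)
open import Data.Product using (_×_)
open import Relation.Nullary using (¬_)
open import Relation.Nullary.Decidable using (⌊_⌋)
open import Relation.Binary.PropositionalEquality using (_≡_)

data Var : Set where
  vx vy : Var

_==ᵛ_ : Var → Var → Bool
vx ==ᵛ vx = true
vy ==ᵛ vy = true
_  ==ᵛ _  = false

-- FO²[<] formulas over the alphabet Σ = Fin k (variables x,y may be requantified).
data FO2 (k : ℕ) : Set where
  tt ff  : FO2 k
  letter : Fin k → Var → FO2 k
  less   : Var → Var → FO2 k
  equal  : Var → Var → FO2 k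
  neg    : FO2 k → FO2 k
  conj   : FO2 k → FO2 k → FO2 k
  disj   : FO2 k → FO2 k → FO2 k
  ex     : Var → FO2 k → FO2 k
  all    : Var → FO2 k → FO2 k

qd : ∀ {k} → FO2 k → ℕ
qd tt = 0
qd ff = 0
qd (letter a v) = 0
qd (less u v) = 0
qd (equal u v) = 0
qd (neg φ) = qd φ
qd (conj φ ψ) = qd φ ⊔ qd ψ
qd (disj φ ψ) = qd φ ⊔ qd ψ
qd (ex v φ) = suc (qd φ)
qd (all v φ) = suc (qd φ)

Free : ∀ {k} → Var → FO2 k → Set
Free v tt = ⊥
Free v ff = ⊥
Free v (letter a u) = v ≡ u
Free v (less u u') = v ≡ u ⊎ v ≡ u'
Free v (equal u u') = v ≡ u ⊎ v ≡ u'
Free v (neg φ) = Free v φ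
Free v (conj φ ψ) = Free v φ ⊎ Free v ψ
Free v (disj φ ψ) = Free v φ ⊎ Free v ψ
Free v (ex u φ) = ¬ (v ≡ u) × Free v φ
Free v (all u φ) = ¬ (v ≡ u) × Free v φ

Sentence : ∀ {k} → FO2 k → Set
Sentence φ = ∀ v → ¬ Free v φ

-- Positions of a word w are 0,…,|w|-1 (0-indexed version of {1,…,|w|}).
letterAt : ∀ {A : Set} → List A → ℕ → Maybe A
letterAt [] i = nothing
letterAt (a ∷ w) zero = just a
letterAt (a ∷ w) (suc i) = letterAt w i

isLetter : ∀ {k} → Fin k → Maybe (Fin k) → Bool
isLetter a nothing = false
isLetter a (just b) = ⌊ a ≟ b ⌋

Assignment : Set
Assignment = Var → ℕ

update : Assignment → Var → ℕ → Assignment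
update ρ v i u with v ==ᵛ u
... | true = i
... | false = ρ u

anyBelow : ℕ → (ℕ → Bool) → Bool
anyBelow zero p = false
anyBelow (suc m) p = p m ∨ anyBelow m p

allBelow : ℕ → (ℕ → Bool) → Bool
allBelow zero p = true
allBelow (suc m) p = p m ∧ allBelow m p

eval : ∀ {k} → List (Fin k) → Assignment → FO2 k → Bool
eval w ρ tt = true
eval w ρ ff = false
eval w ρ (letter a v) = isLetter a (letterAt w (ρ v))
eval w ρ (less u v) = ρ u <ᵇ ρ v
eval w ρ (equal u v) = ρ u ≡ᵇ ρ v
eval w ρ (neg φ) = not (eval w ρ φ)
eval w ρ (conj φ ψ) = eval w ρ φ ∧ eval w ρ ψ
eval w ρ (disj φ ψ) = eval w ρ φ ∨ eval w ρ ψ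
eval w ρ (ex v φ) = anyBelow (length w) (λ i → eval w (update ρ v i) φ)
eval w ρ (all v φ) = allBelow (length w) (λ i → eval w (update ρ v i) φ)

-- w ⊨ φ for a sentence φ (the assignment is irrelevant for sentences)
_⊨_ : ∀ {k} → List (Fin k) → FO2 k → Set
w ⊨ φ = eval w (λ _ → 0) φ ≡ true

module Submission where

-- Write u ≅[ n ] v when Duplicator wins the n-round Ehrenfeucht–Fraïssé
-- game for FO² on the words u and v.  The proof has four parts.
--  1. Soundness: ≅[ n ]-equivalent words satisfy the same sentences of
--     quantifier depth ≤ n.
--  2. ≅[ n ] is a congruence for concatenation.
--  3. Deletion lemma: if U consists of n blocks and V of n blocks, each
--     containing every letter of an alphabet L, then U X V ≅[ n ] U Y V for
--     all words X, Y over L.  Duplicator copies moves inside the first blocks,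
--     mirrors them inside the last blocks, and otherwise answers with the same
--     letter in the next block of U or of V.
--  4. A word over L factors greedily into full blocks (all letters of L occur,
--     the last letter only at the end) and a rest missing some letter of L.
--     Keeping n blocks at each end (3.) and shrinking the block bodies and the
--     rest by induction on the alphabet (2.) gives an equivalent word of length
--     less than (4n)^|L|.
-- Theorem 6.2 follows from 4. for the full alphabet of k letters and 1., with
-- C = 4^k and N = 1.

open import Defs
open import Data.Bool using (Bool; true; false; not; _∧_; _∨_)
open import Data.Empty using (⊥-elim)
open import Data.Fin using (Fin) renaming (_≟_ to _≟ᶠ_)
open import Data.List
  using (List; []; _∷_; length; _++_; _∷ʳ_; concat; map; reverse; take; drop; filter; allFin)
open import Data.List.Membership.Propositional using (_∈_; _∉_)
open import Data.List.Membership.Propositional.Properties using (∈-filter⁺; ∈-filter⁻; ∈-allFin)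
open import Data.List.Properties
  using (length-++; length-map; length-reverse; length-tabulate; length-take; length-drop;
         ++-assoc; ++-identityʳ; map-++; concat-++; unfold-reverse; take++drop≡id; filter-notAll)
open import Data.List.Relation.Binary.Subset.Propositional using (_⊆_)
open import Data.List.Relation.Unary.All as All using (All; []; _∷_)
import Data.List.Relation.Unary.All.Properties as Allₚ
open import Data.List.Relation.Unary.Any as Any using (here; there)
import Data.List.Relation.Unary.Any.Properties as Anyₚ
open import Data.Maybe using (just)
open import Data.Nat
  using (ℕ; zero; suc; _+_; _*_; _^_; _∸_; _≤_; _<_; z≤n; s≤s; _<ᵇ_; _≡ᵇ_; _<?_; _≤?_; >-nonZero)
open import Data.Nat.Induction using (<-wellFounded)
open import Data.Nat.Properties
open import Data.Nat.Tactic.RingSolver using (solve-∀)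
open import Data.Product using (∃; ∃-syntax; _×_; _,_; proj₁; proj₂)
open import Data.Sum using (_⊎_; inj₁; inj₂)
open import Data.Unit using (⊤; tt)
open import Function using (_∘_; id)
open import Induction.WellFounded using (Acc; acc)
open import Relation.Binary using (DecidableEquality; tri<; tri≈; tri>)
open import Relation.Binary.PropositionalEquality
open import Relation.Nullary using (¬_; Dec; yes; no)
open import Relation.Nullary.Decidable using (¬?; _×-dec_; _⊎-dec_)

private variable
  A : Set
  k : ℕ

-- The order type of a pair of positions: all that the atomic formulas
-- x < y and x = y can observe about them.
data Order : Set where
  lt eq gt : Order

order : ℕ → ℕ → Order
order zero    zero    = eq
order zero    (suc _) = lt
order (suc _) zero    = gt
order (suc a) (suc b) = order a b

flip-order : Order → Order
flip-order lt = gt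
flip-order eq = eq
flip-order gt = lt

isLess isEqual : Order → Bool
isLess lt = true
isLess _  = false
isEqual eq = true
isEqual _  = false

order-< : ∀ {a b} → a < b → order a b ≡ lt
order-< {zero}  {suc b} _       = refl
order-< {suc a} {suc b} (s≤s p) = order-< p

order-> : ∀ {a b} → b < a → order a b ≡ gt
order-> {suc a} {zero}  _       = refl
order-> {suc a} {suc b} (s≤s p) = order-> p

order-refl : ∀ a → order a a ≡ eq
order-refl zero    = refl
order-refl (suc a) = order-refl a

order-swap : ∀ a b → order b a ≡ flip-order (order a b)
order-swap zero    zero    = refl
order-swap zero    (suc b) = refl
order-swap (suc a) zero    = refl
order-swap (suc a) (suc b) = order-swap a b

order-+ : ∀ c a b → order (c + a) (c + b) ≡ order a b
order-+ zero    a b = refl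
order-+ (suc c) a b = order-+ c a b

same-order-< : ∀ {a b c d} → a < b → c < d → order a b ≡ order c d
same-order-< a<b c<d = trans (order-< a<b) (sym (order-< c<d))

same-order-> : ∀ {a b c d} → b < a → d < c → order a b ≡ order c d
same-order-> b<a d<c = trans (order-> b<a) (sym (order-> d<c))

<ᵇ-order : ∀ a b → (a <ᵇ b) ≡ isLess (order a b)
<ᵇ-order zero    zero    = refl
<ᵇ-order zero    (suc b) = refl
<ᵇ-order (suc a) zero    = refl
<ᵇ-order (suc a) (suc b) = <ᵇ-order a b

≡ᵇ-order : ∀ a b → (a ≡ᵇ b) ≡ isEqual (order a b)
≡ᵇ-order zero    zero    = refl
≡ᵇ-order zero    (suc b) = refl
≡ᵇ-order (suc a) zero    = refl
≡ᵇ-order (suc a) (suc b) = ≡ᵇ-order a b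

-- Pebbled m u i v j: Duplicator wins the m-round FO² Ehrenfeucht–Fraïssé game
-- on u and v from the position with the pebbles on i in u and on j in v.
Pebbled : ℕ → List A → ℕ → List A → ℕ → Set
Pebbled zero    u i v j = letterAt u i ≡ letterAt v j
Pebbled (suc m) u i v j = letterAt u i ≡ letterAt v j
  × (∀ i' → i' < length u → ∃[ j' ] j' < length v × order i' i ≡ order j' j × Pebbled m u i' v j')
  × (∀ j' → j' < length v → ∃[ i' ] i' < length u × order i' i ≡ order j' j × Pebbled m u i' v j')

-- u ≅[ n ] v: Duplicator wins the n-round game on u and v, where the first
-- round places the pebble.
_≅[_]_ : List A → ℕ → List A → Set
u ≅[ zero ]  v = ⊤
u ≅[ suc m ] v = (∀ i → i < length u → ∃[ j ] j < length v × Pebbled m u i v j)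
               × (∀ j → j < length v → ∃[ i ] i < length u × Pebbled m u i v j)

pebbled-letter : ∀ m {u v : List A} {i j} → Pebbled m u i v j → letterAt u i ≡ letterAt v j
pebbled-letter zero    e = e
pebbled-letter (suc m) e = proj₁ e

pebbled-suc : ∀ m {u v : List A} {i j} → Pebbled (suc m) u i v j → Pebbled m u i v j
pebbled-suc zero    e = proj₁ e
pebbled-suc (suc m) (l , forth , back) =
    l
  , (λ i' i'<u → let (j' , j'<v , o , e) = forth i' i'<u in j' , j'<v , o , pebbled-suc m e)
  , (λ j' j'<v → let (i' , i'<u , o , e) = back j' j'<v in i' , i'<u , o , pebbled-suc m e)

pebbled-≤ : ∀ {m n} {u v : List A} {i j} → m ≤ n → Pebbled n u i v j → Pebbled m u i v j
pebbled-≤ {n = zero}  z≤n e = e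
pebbled-≤ {n = suc n} m≤1+n e with m≤n⇒m<n∨m≡n m≤1+n
... | inj₂ refl      = e
... | inj₁ (s≤s m≤n) = pebbled-≤ m≤n (pebbled-suc n e)

≅-suc : ∀ m {u v : List A} → u ≅[ suc m ] v → u ≅[ m ] v
≅-suc zero    _ = tt
≅-suc (suc m) (forth , back) =
    (λ i i<u → let (j , j<v , e) = forth i i<u in j , j<v , pebbled-suc m e)
  , (λ j j<v → let (i , i<u , e) = back j j<v in i , i<u , pebbled-suc m e)

pebbled-refl : ∀ m (u : List A) i → Pebbled m u i u i
pebbled-refl zero    u i = refl
pebbled-refl (suc m) u i =
  refl , (λ i' l → i' , l , refl , pebbled-refl m u i') , (λ i' l → i' , l , refl , pebbled-refl m u i')

≅-refl : ∀ m (u : List A) → u ≅[ m ] u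
≅-refl zero    u = tt
≅-refl (suc m) u = (λ i l → i , l , pebbled-refl m u i) , (λ i l → i , l , pebbled-refl m u i)

pebbled-sym : ∀ m {u v : List A} {i j} → Pebbled m u i v j → Pebbled m v j u i
pebbled-sym zero    e = sym e
pebbled-sym (suc m) (l , forth , back) =
    sym l
  , (λ j' j'<v → let (i' , i'<u , o , e) = back j' j'<v in i' , i'<u , sym o , pebbled-sym m e)
  , (λ i' i'<u → let (j' , j'<v , o , e) = forth i' i'<u in j' , j'<v , sym o , pebbled-sym m e)

≅-sym : ∀ m {u v : List A} → u ≅[ m ] v → v ≅[ m ] u
≅-sym zero    _ = tt
≅-sym (suc m) (forth , back) =
    (λ j j<v → let (i , i<u , e) = back j j<v in i , i<u , pebbled-sym m e)
  , (λ i i<u → let (j , j<v , e) = forth i i<u in j , j<v , pebbled-sym m e)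

pebbled-trans : ∀ m {u v w : List A} {i j l} → Pebbled m u i v j → Pebbled m v j w l → Pebbled m u i w l
pebbled-trans zero    e₁ e₂ = trans e₁ e₂
pebbled-trans (suc m) (l₁ , forth₁ , back₁) (l₂ , forth₂ , back₂) =
    trans l₁ l₂
  , (λ i' i'<u → let (j' , j'<v , o₁ , e₁) = forth₁ i' i'<u
                     (l' , l'<w , o₂ , e₂) = forth₂ j' j'<v
                 in l' , l'<w , trans o₁ o₂ , pebbled-trans m e₁ e₂)
  , (λ l' l'<w → let (j' , j'<v , o₂ , e₂) = back₂ l' l'<w
                     (i' , i'<u , o₁ , e₁) = back₁ j' j'<v
                 in i' , i'<u , trans o₁ o₂ , pebbled-trans m e₁ e₂)

≅-trans : ∀ m {u v w : List A} → u ≅[ m ] v → v ≅[ m ] w → u ≅[ m ] w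
≅-trans zero    _ _ = tt
≅-trans (suc m) (forth₁ , back₁) (forth₂ , back₂) =
    (λ i i<u → let (j , j<v , e₁) = forth₁ i i<u ; (l , l<w , e₂) = forth₂ j j<v
               in l , l<w , pebbled-trans m e₁ e₂)
  , (λ l l<w → let (j , j<v , e₂) = back₂ l l<w ; (i , i<u , e₁) = back₁ j j<v
               in i , i<u , pebbled-trans m e₁ e₂)

module Strategy {u v : List A} (R : ℕ → ℕ → ℕ → Set)
  (letters : ∀ {m p p'} → R m p p' → letterAt u p ≡ letterAt v p')
  (forth : ∀ {m p p'} → R (suc m) p p' → ∀ q → q < length u →
             ∃[ q' ] q' < length v × order q p ≡ order q' p' × R m q q')
  (back : ∀ {m p p'} → R (suc m) p p' → ∀ q' → q' < length v →
            ∃[ q ] q < length u × order q p ≡ order q' p' × R m q q')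
  where

  wins-from : ∀ m {p p'} → R m p p' → Pebbled m u p v p'
  wins-from zero    r = letters r
  wins-from (suc m) r =
      letters r
    , (λ q q<u → let (q' , q'<v , o , r') = forth r q q<u in q' , q'<v , o , wins-from m r')
    , (λ q' q'<v → let (q , q<u , o , r') = back r q' q'<v in q , q<u , o , wins-from m r')

  wins : ∀ m → (∀ q → q < length u → ∃[ q' ] q' < length v × R m q q')
             → (∀ q' → q' < length v → ∃[ q ] q < length u × R m q q')
             → u ≅[ suc m ] v
  wins m start start-back =
      (λ q q<u → let (q' , q'<v , r) = start q q<u in q' , q'<v , wins-from m r)
    , (λ q' q'<v → let (q , q<u , r) = start-back q' q'<v in q , q<u , wins-from m r)

other : Var → Var
other vx = vy
other vy = vx

other≢ : ∀ x → ¬ other x ≡ x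
other≢ vx ()
other≢ vy ()

var-cases : ∀ x p → p ≡ x ⊎ p ≡ other x
var-cases vx vx = inj₁ refl
var-cases vx vy = inj₂ refl
var-cases vy vx = inj₂ refl
var-cases vy vy = inj₁ refl

_≟ᵛ_ : (p q : Var) → Dec (p ≡ q)
vx ≟ᵛ vx = yes refl
vx ≟ᵛ vy = no λ ()
vy ≟ᵛ vx = no λ ()
vy ≟ᵛ vy = yes refl

update-self : ∀ ρ x i → update ρ x i x ≡ i
update-self ρ vx i = refl
update-self ρ vy i = refl

update-other : ∀ ρ x i → update ρ x i (other x) ≡ ρ (other x)
update-other ρ vx i = refl
update-other ρ vy i = refl

-- Freeness of a variable is decidable; Duplicator's answer to a quantifier
-- depends on whether the other variable is free in its body.
free? : ∀ p (φ : FO2 k) → Dec (Free p φ)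
free? p tt           = no λ ()
free? p ff           = no λ ()
free? p (letter a q) = p ≟ᵛ q
free? p (less q r)   = (p ≟ᵛ q) ⊎-dec (p ≟ᵛ r)
free? p (equal q r)  = (p ≟ᵛ q) ⊎-dec (p ≟ᵛ r)
free? p (neg φ)      = free? p φ
free? p (conj φ ψ)   = free? p φ ⊎-dec free? p ψ
free? p (disj φ ψ)   = free? p φ ⊎-dec free? p ψ
free? p (ex q φ)     = ¬? (p ≟ᵛ q) ×-dec free? p φ
free? p (all q φ)    = ¬? (p ≟ᵛ q) ×-dec free? p φ

anyBelow-true : ∀ m f → anyBelow m f ≡ true → ∃[ i ] i < m × f i ≡ true
anyBelow-true (suc m) f any with f m in fm
... | true  = m , ≤-refl , fm
... | false = let (i , i<m , fi) = anyBelow-true m f any in i , m≤n⇒m≤1+n i<m , fi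

anyBelow-witness : ∀ m f {i} → i < m → f i ≡ true → anyBelow m f ≡ true
anyBelow-witness (suc m) f {i} (s≤s i≤m) fi with f m in fm
... | true  = refl
... | false with m≤n⇒m<n∨m≡n i≤m
...   | inj₁ i<m = anyBelow-witness m f i<m fi
...   | inj₂ refl with trans (sym fi) fm
...     | ()

allBelow-as-any : ∀ m f → allBelow m f ≡ not (anyBelow m (not ∘ f))
allBelow-as-any zero    f = refl
allBelow-as-any (suc m) f with f m
... | true  = allBelow-as-any m f
... | false = refl

true-iff : ∀ {a b : Bool} → (a ≡ true → b ≡ true) → (b ≡ true → a ≡ true) → a ≡ b
true-iff {true}  {true}  _ _ = refl
true-iff {true}  {false} f _ = sym (f refl)
true-iff {false} {true}  _ g = g refl
true-iff {false} {false} _ _ = refl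

anyBelow-cong : ∀ m m' f g
  → (∀ i → i < m → ∃[ j ] j < m' × f i ≡ g j)
  → (∀ j → j < m' → ∃[ i ] i < m × g j ≡ f i)
  → anyBelow m f ≡ anyBelow m' g
anyBelow-cong m m' f g match match-back = true-iff
  (λ any-f → let (i , i<m , fi) = anyBelow-true m f any-f ; (j , j<m' , fi≡gj) = match i i<m
             in anyBelow-witness m' g j<m' (trans (sym fi≡gj) fi))
  (λ any-g → let (j , j<m' , gj) = anyBelow-true m' g any-g ; (i , i<m , gj≡fi) = match-back j j<m'
             in anyBelow-witness m f i<m (trans (sym gj≡fi) gj))

allBelow-cong : ∀ m m' f g
  → (∀ i → i < m → ∃[ j ] j < m' × f i ≡ g j)
  → (∀ j → j < m' → ∃[ i ] i < m × g j ≡ f i)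
  → allBelow m f ≡ allBelow m' g
allBelow-cong m m' f g match match-back = begin
  allBelow m f                   ≡⟨ allBelow-as-any m f ⟩
  not (anyBelow m (not ∘ f))     ≡⟨ cong not (anyBelow-cong m m' (not ∘ f) (not ∘ g) match¬ match-back¬) ⟩
  not (anyBelow m' (not ∘ g))    ≡⟨ sym (allBelow-as-any m' g) ⟩
  allBelow m' g                  ∎
  where
  open ≡-Reasoning
  match¬ : ∀ i → i < m → ∃[ j ] j < m' × not (f i) ≡ not (g j)
  match¬ i i<m = let (j , j<m' , e) = match i i<m in j , j<m' , cong not e
  match-back¬ : ∀ j → j < m' → ∃[ i ] i < m × not (g j) ≡ not (f i)
  match-back¬ j j<m' = let (i , i<m , e) = match-back j j<m' in i , i<m , cong not e

record Agree (m : ℕ) (F : Var → Set) (u v : List A) (ρ σ : Assignment) : Set where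
  field
    pebbled : ∀ p → F p → Pebbled m u (ρ p) v (σ p)
    ordered : ∀ p q → F p → F q → order (ρ p) (ρ q) ≡ order (σ p) (σ q)
open Agree

agree-restrict : ∀ {m} {F G : Var → Set} {u v : List A} {ρ σ}
  → (∀ p → F p → G p) → Agree m G u v ρ σ → Agree m F u v ρ σ
agree-restrict F⊆G a = record
  { pebbled = λ p Fp → pebbled a p (F⊆G p Fp)
  ; ordered = λ p q Fp Fq → ordered a p q (F⊆G p Fp) (F⊆G q Fq) }

agree-sym : ∀ {m F} {u v : List A} {ρ σ} → Agree m F u v ρ σ → Agree m F v u σ ρ
agree-sym {m = m} a = record
  { pebbled = λ p Fp → pebbled-sym m (pebbled a p Fp)
  ; ordered = λ p q Fp Fq → sym (ordered a p q Fp Fq) }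

agree-update : ∀ {n x F} {u v : List A} {ρ σ i j}
  → Agree (suc n) (λ p → ¬ p ≡ x × F p) u v ρ σ
  → Pebbled n u i v j
  → (F (other x) → order i (ρ (other x)) ≡ order j (σ (other x)))
  → Agree n F u v (update ρ x i) (update σ x j)
agree-update {n = n} {x} {F} {u} {v} {ρ} {σ} {i} {j} a e same-order = record
  { pebbled = pebbled′ ; ordered = ordered′ }
  where
  y = other x
  y-agrees : F y → ¬ y ≡ x × F y
  y-agrees Fy = other≢ x , Fy

  pebbled′ : ∀ p → F p → Pebbled n u (update ρ x i p) v (update σ x j p)
  pebbled′ p Fp with var-cases x p
  ... | inj₁ refl rewrite update-self ρ p i | update-self σ p j = e
  ... | inj₂ refl rewrite update-other ρ x i | update-other σ x j =
    pebbled-suc n (pebbled a y (y-agrees Fp))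

  ordered′ : ∀ p q → F p → F q →
    order (update ρ x i p) (update ρ x i q) ≡ order (update σ x j p) (update σ x j q)
  ordered′ p q Fp Fq with var-cases x p | var-cases x q
  ... | inj₁ refl | inj₁ refl rewrite update-self ρ p i | update-self σ p j =
    trans (order-refl i) (sym (order-refl j))
  ... | inj₁ refl | inj₂ refl rewrite update-self ρ p i | update-self σ p j
                                    | update-other ρ p i | update-other σ p j = same-order Fq
  ... | inj₂ refl | inj₁ refl rewrite update-self ρ q i | update-self σ q j
                                    | update-other ρ q i | update-other σ q j =
    trans (order-swap i (ρ (other q))) (trans (cong flip-order (same-order Fp)) (sym (order-swap j (σ (other q)))))
  ... | inj₂ refl | inj₂ refl rewrite update-other ρ x i | update-other σ x j =
    ordered a y y (y-agrees Fp) (y-agrees Fq)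

-- Duplicator's answer to Spoiler placing the bound variable x of ∃x φ / ∀x φ
-- on position i of u: if the other variable is free in φ, answer as in the
-- game pebbled on it; otherwise start a fresh game.
extend : ∀ {n x} (φ : FO2 k) {u v : List A} {ρ σ} → u ≅[ suc n ] v
  → Agree (suc n) (λ p → ¬ p ≡ x × Free p φ) u v ρ σ
  → ∀ i → i < length u
  → ∃[ j ] j < length v × Agree n (λ p → Free p φ) u v (update ρ x i) (update σ x j)
extend {x = x} φ game a i i<u with free? (other x) φ
... | yes y-free =
  let (j , j<v , o , e) = proj₁ (proj₂ (pebbled a (other x) (other≢ x , y-free))) i i<u
  in j , j<v , agree-update a e (λ _ → o)
... | no y-bound =
  let (j , j<v , e) = proj₁ game i i<u
  in j , j<v , agree-update a e (⊥-elim ∘ y-bound)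

quantifier-match : ∀ {n x} (φ : FO2 k)
  → (∀ {u v : List (Fin k)} {ρ σ} → u ≅[ n ] v → Agree n (λ p → Free p φ) u v ρ σ
       → eval u ρ φ ≡ eval v σ φ)
  → ∀ {u v : List (Fin k)} {ρ σ} → u ≅[ suc n ] v → Agree (suc n) (λ p → ¬ p ≡ x × Free p φ) u v ρ σ
  → ∀ i → i < length u → ∃[ j ] j < length v × eval u (update ρ x i) φ ≡ eval v (update σ x j) φ
quantifier-match {n = n} φ preserves game a i i<u =
  let (j , j<v , a′) = extend φ game a i i<u in j , j<v , preserves (≅-suc n game) a′

sound : ∀ n (φ : FO2 k) → qd φ ≤ n → ∀ {u v : List (Fin k)} {ρ σ} → u ≅[ n ] v
  → Agree n (λ p → Free p φ) u v ρ σ → eval u ρ φ ≡ eval v σ φ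
sound n tt d game a = refl
sound n ff d game a = refl
sound n (letter c p) d game a = cong (isLetter c) (pebbled-letter n (pebbled a p refl))
sound n (less p q) d {ρ = ρ} {σ} game a = begin
  ρ p <ᵇ ρ q                 ≡⟨ <ᵇ-order (ρ p) (ρ q) ⟩
  isLess (order (ρ p) (ρ q)) ≡⟨ cong isLess (ordered a p q (inj₁ refl) (inj₂ refl)) ⟩
  isLess (order (σ p) (σ q)) ≡⟨ sym (<ᵇ-order (σ p) (σ q)) ⟩
  σ p <ᵇ σ q                 ∎
  where open ≡-Reasoning
sound n (equal p q) d {ρ = ρ} {σ} game a = begin
  ρ p ≡ᵇ ρ q                  ≡⟨ ≡ᵇ-order (ρ p) (ρ q) ⟩
  isEqual (order (ρ p) (ρ q)) ≡⟨ cong isEqual (ordered a p q (inj₁ refl) (inj₂ refl)) ⟩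
  isEqual (order (σ p) (σ q)) ≡⟨ sym (≡ᵇ-order (σ p) (σ q)) ⟩
  σ p ≡ᵇ σ q                  ∎
  where open ≡-Reasoning
sound n (neg φ) d game a = cong not (sound n φ d game a)
sound n (conj φ ψ) d game a =
  cong₂ _∧_ (sound n φ (m⊔n≤o⇒m≤o (qd φ) (qd ψ) d) game (agree-restrict (λ _ → inj₁) a))
            (sound n ψ (m⊔n≤o⇒n≤o (qd φ) (qd ψ) d) game (agree-restrict (λ _ → inj₂) a))
sound n (disj φ ψ) d game a =
  cong₂ _∨_ (sound n φ (m⊔n≤o⇒m≤o (qd φ) (qd ψ) d) game (agree-restrict (λ _ → inj₁) a))
            (sound n ψ (m⊔n≤o⇒n≤o (qd φ) (qd ψ) d) game (agree-restrict (λ _ → inj₂) a))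
sound (suc n) (ex x φ) (s≤s d) {u} {v} game a =
  anyBelow-cong (length u) (length v) _ _
    (quantifier-match φ (sound n φ d) game a)
    (quantifier-match φ (sound n φ d) (≅-sym (suc n) game) (agree-sym a))
sound (suc n) (all x φ) (s≤s d) {u} {v} game a =
  allBelow-cong (length u) (length v) _ _
    (quantifier-match φ (sound n φ d) game a)
    (quantifier-match φ (sound n φ d) (≅-sym (suc n) game) (agree-sym a))

≅-preserves-sentence : ∀ n (φ : FO2 k) → qd φ ≤ n → Sentence φ
  → ∀ {u v : List (Fin k)} → u ≅[ n ] v → u ⊨ φ → v ⊨ φ
≅-preserves-sentence n φ d closed game u⊨φ =
  trans (sym (sound n φ d game no-free-variables)) u⊨φ
  where
  no-free-variables = record
    { pebbled = λ p Fp → ⊥-elim (closed p Fp)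
    ; ordered = λ p q Fp _ → ⊥-elim (closed p Fp) }

letterAt-++ˡ : ∀ (u v : List A) {i} → i < length u → letterAt (u ++ v) i ≡ letterAt u i
letterAt-++ˡ (c ∷ u) v {zero}  _         = refl
letterAt-++ˡ (c ∷ u) v {suc i} (s≤s i<u) = letterAt-++ˡ u v i<u

letterAt-++ʳ : ∀ (u v : List A) i → letterAt (u ++ v) (length u + i) ≡ letterAt v i
letterAt-++ʳ []      v i = refl
letterAt-++ʳ (c ∷ u) v i = letterAt-++ʳ u v i

<-++ˡ : ∀ (u v : List A) {i} → i < length u → i < length (u ++ v)
<-++ˡ u v i<u = subst (_ <_) (sym (length-++ u)) (≤-trans i<u (m≤m+n _ _))

<-++ʳ : ∀ (u v : List A) {i} → i < length v → length u + i < length (u ++ v)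
<-++ʳ u v i<v = subst (_ <_) (sym (length-++ u)) (+-monoʳ-< (length u) i<v)

position-++ : ∀ (u v : List A) q → q < length (u ++ v)
  → q < length u ⊎ ∃[ a ] q ≡ length u + a × a < length v
position-++ u v q q<uv with q <? length u
... | yes q<u = inj₁ q<u
... | no  q≮u = inj₂ (q ∸ length u , sym (m+[n∸m]≡n (≮⇒≥ q≮u)) , a<v)
  where
  a<v : q ∸ length u < length v
  a<v = +-cancelˡ-< (length u) _ _ (subst₂ _<_ (sym (m+[n∸m]≡n (≮⇒≥ q≮u))) (length-++ u) q<uv)

-- Duplicator's strategy on u ++ v versus u' ++ v': play the game on u, u'
-- while Spoiler stays in the left factors and the game on v, v' while he
-- stays in the right factors, starting afresh when he switches sides.
data SameFactor (u v u' v' : List A) (m : ℕ) : ℕ → ℕ → Set where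
  left  : ∀ {p p'} → p < length u → p' < length u' → Pebbled m u p u' p' → SameFactor u v u' v' m p p'
  right : ∀ {a b} → Pebbled m v a v' b → SameFactor u v u' v' m (length u + a) (length u' + b)

same-factor-sym : ∀ {m} {u v u' v' : List A} {p p'} → SameFactor u v u' v' m p p' → SameFactor u' v' u v m p' p
same-factor-sym {m = m} (left p<u p'<u' e) = left p'<u' p<u (pebbled-sym m e)
same-factor-sym {m = m} (right e)          = right (pebbled-sym m e)

module Concat {n : ℕ} {u u' v v' : List A} (u≅u' : u ≅[ suc n ] u') (v≅v' : v ≅[ suc n ] v') where

  R : ℕ → ℕ → ℕ → Set
  R m p p' = m ≤ n × SameFactor u v u' v' m p p'

  letters : ∀ {m p p'} → R m p p' → letterAt (u ++ v) p ≡ letterAt (u' ++ v') p'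
  letters {m} (_ , left p<u p'<u' e) =
    trans (letterAt-++ˡ u v p<u) (trans (pebbled-letter m e) (sym (letterAt-++ˡ u' v' p'<u')))
  letters {m} (_ , right {a} {b} e) =
    trans (letterAt-++ʳ u v a) (trans (pebbled-letter m e) (sym (letterAt-++ʳ u' v' b)))

  enter-left : ∀ {m q} → m ≤ n → q < length u → ∃[ q' ] q' < length (u' ++ v') × R m q q'
  enter-left m≤n q<u =
    let (q' , q'<u' , e) = proj₁ u≅u' _ q<u
    in q' , <-++ˡ u' v' q'<u' , m≤n , left q<u q'<u' (pebbled-≤ m≤n e)

  enter-right : ∀ {m a} → m ≤ n → a < length v
    → ∃[ b ] length u' + b < length (u' ++ v') × R m (length u + a) (length u' + b)
  enter-right m≤n a<v =
    let (b , b<v' , e) = proj₁ v≅v' _ a<v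
    in b , <-++ʳ u' v' b<v' , m≤n , right (pebbled-≤ m≤n e)

  start : ∀ q → q < length (u ++ v) → ∃[ q' ] q' < length (u' ++ v') × R n q q'
  start q q<uv with position-++ u v q q<uv
  ... | inj₁ q<u = enter-left ≤-refl q<u
  ... | inj₂ (a , refl , a<v) = let (b , l , r) = enter-right ≤-refl a<v in length u' + b , l , r

  forth : ∀ {m p p'} → R (suc m) p p' → ∀ q → q < length (u ++ v)
    → ∃[ q' ] q' < length (u' ++ v') × order q p ≡ order q' p' × R m q q'
  forth {m} (m<n , left p<u p'<u' e) q q<uv with position-++ u v q q<uv
  ... | inj₁ q<u =
    let (q' , q'<u' , o , e') = proj₁ (proj₂ e) q q<u
    in q' , <-++ˡ u' v' q'<u' , o , <⇒≤ m<n , left q<u q'<u' e'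
  ... | inj₂ (a , refl , a<v) =
    let (b , l , r) = enter-right (<⇒≤ m<n) a<v
    in length u' + b , l
     , same-order-> (≤-trans p<u (m≤m+n _ a)) (≤-trans p'<u' (m≤m+n _ b)) , r
  forth {m} (m<n , right {a} {b} e) q q<uv with position-++ u v q q<uv
  ... | inj₁ q<u =
    let (q' , l , r) = enter-left (<⇒≤ m<n) q<u
    in q' , l , same-order-< (≤-trans q<u (m≤m+n _ a)) (in-left r) , r
    where
    in-left : ∀ {q'} → R m q q' → q' < length u' + b
    in-left (_ , left _ q'<u' _) = ≤-trans q'<u' (m≤m+n _ b)
    in-left (_ , right _)        = ⊥-elim (<⇒≱ q<u (m≤m+n _ _))
  ... | inj₂ (a' , refl , a'<v) =
    let (b' , b'<v' , o , e') = proj₁ (proj₂ e) a' a'<v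
    in length u' + b' , <-++ʳ u' v' b'<v'
     , trans (order-+ (length u) a' a) (trans o (sym (order-+ (length u') b' b)))
     , <⇒≤ m<n , right e'

≅-++ : ∀ n {u u' v v' : List A} → u ≅[ n ] u' → v ≅[ n ] v' → (u ++ v) ≅[ n ] (u' ++ v')
≅-++ zero    _      _      = tt
≅-++ (suc n) u≅u' v≅v' =
  Strategy.wins Forward.R Forward.letters Forward.forth back n Forward.start start-back
  where
  module Forward  = Concat u≅u' v≅v'
  module Backward = Concat (≅-sym (suc n) u≅u') (≅-sym (suc n) v≅v')
  back : ∀ {m p p'} → Forward.R (suc m) p p' → ∀ q' → q' < _
    → ∃[ q ] q < _ × order q p ≡ order q' p' × Forward.R m q q'
  back (m<n , l) q' q'<u'v' =
    let (q , q<uv , o , m≤n , l') = Backward.forth (m<n , same-factor-sym l) q' q'<u'v'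
    in q , q<uv , sym o , m≤n , same-factor-sym l'
  start-back : ∀ q' → q' < _ → ∃[ q ] q < _ × Forward.R n q q'
  start-back q' q'<u'v' =
    let (q , q<uv , m≤n , l) = Backward.start q' q'<u'v' in q , q<uv , m≤n , same-factor-sym l

letterAt-just : ∀ (w : List A) {i} → i < length w → ∃[ a ] letterAt w i ≡ just a
letterAt-just (c ∷ w) {zero}  _         = c , refl
letterAt-just (c ∷ w) {suc i} (s≤s i<w) = letterAt-just w i<w

-- Positions p of a word of length N and p' of a word of length N' are
-- mirrored if they lie at the same distance from the respective ends.
record Mirrored (N N' p p' : ℕ) : Set where
  constructor mirror
  field balance : p + N' ≡ p' + N

mirrored-< : ∀ {N N' p p' q q'} → Mirrored N N' p p' → Mirrored N N' q q' → q < p → q' < p'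
mirrored-< {N} {N'} {p} {p'} {q} {q'} (mirror mp) (mirror mq) q<p = +-cancelʳ-< N q' p' (begin-strict
  q' + N ≡⟨ sym mq ⟩
  q + N' <⟨ +-monoˡ-< N' q<p ⟩
  p + N' ≡⟨ mp ⟩
  p' + N ∎)
  where open ≤-Reasoning

mirrored-near-end : ∀ {N N' p p' s} → Mirrored N N' p p' → N ≤ p + s → N' ≤ p' + s
mirrored-near-end {N} {N'} {p} {p'} {s} (mirror mp) N≤p+s = +-cancelʳ-≤ N N' (p' + s) (begin
  N' + N       ≤⟨ +-monoʳ-≤ N' N≤p+s ⟩
  N' + (p + s) ≡⟨ rearrange N' p s ⟩
  (p + N') + s ≡⟨ cong (_+ s) mp ⟩
  (p' + N) + s ≡⟨ rearrange′ p' N s ⟩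
  (p' + s) + N ∎)
  where
  open ≤-Reasoning
  rearrange : ∀ a b c → a + (b + c) ≡ (b + a) + c
  rearrange = solve-∀
  rearrange′ : ∀ a b c → (a + b) + c ≡ (a + c) + b
  rearrange′ = solve-∀

mirrored-sym : ∀ {N N' p p'} → Mirrored N N' p p' → Mirrored N' N p' p
mirrored-sym (mirror mp) = mirror (sym mp)

far-before-near : ∀ {N N' p t s} → p + s < N → N' ≤ t + s → p + N' < t + N
far-before-near {N} {N'} {p} {t} {s} p+s<N N'≤t+s = begin-strict
  p + N'       ≤⟨ +-monoʳ-≤ p N'≤t+s ⟩
  p + (t + s)  ≡⟨ rearrange p t s ⟩
  t + (p + s)  <⟨ +-monoʳ-< t p+s<N ⟩
  t + N        ∎
  where
  open ≤-Reasoning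
  rearrange : ∀ a b c → a + (b + c) ≡ b + (a + c)
  rearrange = solve-∀

-- Both words share a prefix consisting of n blocks, of total length P m for
-- the first m of them, and a suffix of n blocks, of total length S m for the
-- last m of them; every letter of either word occurs in every one of these
-- blocks of the other word.
record Frame (w₁ w₂ : List A) (n : ℕ) : Set where
  field
    P S    : ℕ → ℕ
    P-mono : ∀ {a b} → a ≤ b → P a ≤ P b
    S-mono : ∀ {a b} → a ≤ b → S a ≤ S b
    fits₁  : P n + S n ≤ length w₁
    fits₂  : P n + S n ≤ length w₂
    common-prefix : ∀ p → p < P n → letterAt w₁ p ≡ letterAt w₂ p
    common-suffix : ∀ p p' → Mirrored (length w₁) (length w₂) p p' → length w₁ ≤ p + S n
                      → letterAt w₁ p ≡ letterAt w₂ p'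
    prefix-block₁ : ∀ m → m < n → ∀ q a → letterAt w₁ q ≡ just a
                      → ∃[ q' ] P m ≤ q' × q' < P (suc m) × letterAt w₂ q' ≡ just a
    prefix-block₂ : ∀ m → m < n → ∀ q a → letterAt w₂ q ≡ just a
                      → ∃[ q' ] P m ≤ q' × q' < P (suc m) × letterAt w₁ q' ≡ just a
    suffix-block₁ : ∀ m → m < n → ∀ q a → letterAt w₁ q ≡ just a
                      → ∃[ q' ] q' + S m < length w₂ × length w₂ ≤ q' + S (suc m) × letterAt w₂ q' ≡ just a
    suffix-block₂ : ∀ m → m < n → ∀ q a → letterAt w₂ q ≡ just a
                      → ∃[ q' ] q' + S m < length w₁ × length w₁ ≤ q' + S (suc m) × letterAt w₁ q' ≡ just a

frame-swap : ∀ {n} {w₁ w₂ : List A} → Frame w₁ w₂ n → Frame w₂ w₁ n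
frame-swap F = record
  { P = P ; S = S ; P-mono = P-mono ; S-mono = S-mono ; fits₁ = fits₂ ; fits₂ = fits₁
  ; common-prefix = λ p p<P → sym (common-prefix p p<P)
  ; common-suffix = λ p p' mp near → sym (common-suffix p' p (mirrored-sym mp) (mirrored-near-end mp near))
  ; prefix-block₁ = prefix-block₂ ; prefix-block₂ = prefix-block₁
  ; suffix-block₁ = suffix-block₂ ; suffix-block₂ = suffix-block₁ }
  where open Frame F

-- Duplicator's strategy for a frame, with m rounds to go: positions in the
-- first m prefix blocks are copied, positions in the last m suffix blocks are
-- mirrored, and otherwise only the letters have to agree.
record Linked {w₁ w₂ : List A} {n} (F : Frame w₁ w₂ n) (m p p' : ℕ) : Set where
  open Frame F
  field
    rounds        : m < n
    p<w₁          : p < length w₁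
    p'<w₂         : p' < length w₂
    same-letter   : letterAt w₁ p ≡ letterAt w₂ p'
    copied        : p < P m ⊎ p' < P m → p ≡ p'
    mirrored      : length w₁ ≤ p + S m ⊎ length w₂ ≤ p' + S m → Mirrored (length w₁) (length w₂) p p'

linked-swap : ∀ {n} {w₁ w₂ : List A} {F : Frame w₁ w₂ n} {m p p'}
  → Linked F m p p' → Linked (frame-swap F) m p' p
linked-swap l = record
  { rounds = rounds ; p<w₁ = p'<w₂ ; p'<w₂ = p<w₁ ; same-letter = sym same-letter
  ; copied = λ { (inj₁ h) → sym (copied (inj₂ h)) ; (inj₂ h) → sym (copied (inj₁ h)) }
  ; mirrored = λ { (inj₁ h) → mirrored-sym (mirrored (inj₂ h)) ; (inj₂ h) → mirrored-sym (mirrored (inj₁ h)) } }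
  where open Linked l

linked-unswap : ∀ {n} {w₁ w₂ : List A} {F : Frame w₁ w₂ n} {m p p'}
  → Linked (frame-swap F) m p' p → Linked F m p p'
linked-unswap l = record
  { rounds = rounds ; p<w₁ = p'<w₂ ; p'<w₂ = p<w₁ ; same-letter = sym same-letter
  ; copied = λ { (inj₁ h) → sym (copied (inj₂ h)) ; (inj₂ h) → sym (copied (inj₁ h)) }
  ; mirrored = λ { (inj₁ h) → mirrored-sym (mirrored (inj₂ h)) ; (inj₂ h) → mirrored-sym (mirrored (inj₁ h)) } }
  where open Linked l

module Deletion {w₁ w₂ : List A} {n} (F : Frame w₁ w₂ n) where
  open Frame F
  open Linked

  N₁ N₂ : ℕ
  N₁ = length w₁
  N₂ = length w₂

  near-end⇒after-prefix₁ : ∀ {s q} → s ≤ n → N₁ ≤ q + S s → P n ≤ q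
  near-end⇒after-prefix₁ {s} {q} s≤n near =
    +-cancelʳ-≤ (S n) (P n) q (≤-trans fits₁ (≤-trans near (+-monoʳ-≤ q (S-mono s≤n))))

  near-end⇒after-prefix₂ : ∀ {s q} → s ≤ n → N₂ ≤ q + S s → P n ≤ q
  near-end⇒after-prefix₂ {s} {q} s≤n near =
    +-cancelʳ-≤ (S n) (P n) q (≤-trans fits₂ (≤-trans near (+-monoʳ-≤ q (S-mono s≤n))))

  in-prefix₁ : ∀ {m q} → m ≤ n → q < P m → q < N₁
  in-prefix₁ m≤n q<P = <-≤-trans q<P (≤-trans (P-mono m≤n) (≤-trans (m≤m+n _ _) fits₁))

  in-prefix₂ : ∀ {m q} → m ≤ n → q < P m → q < N₂
  in-prefix₂ m≤n q<P = <-≤-trans q<P (≤-trans (P-mono m≤n) (≤-trans (m≤m+n _ _) fits₂))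

  fewer : ∀ {m p p'} → Linked F (suc m) p p' → m < n
  fewer l = <-trans (n<1+n _) (rounds l)

  linked-suc : ∀ {m p p'} → Linked F (suc m) p p' → Linked F m p p'
  linked-suc {m} {p} {p'} l = record
    { rounds = fewer l ; p<w₁ = p<w₁ l ; p'<w₂ = p'<w₂ l ; same-letter = same-letter l
    ; copied   = λ { (inj₁ h) → copied l (inj₁ (<-≤-trans h (P-mono (n≤1+n m))))
                   ; (inj₂ h) → copied l (inj₂ (<-≤-trans h (P-mono (n≤1+n m)))) }
    ; mirrored = λ { (inj₁ h) → mirrored l (inj₁ (≤-trans h (+-monoʳ-≤ p (S-mono (n≤1+n m)))))
                   ; (inj₂ h) → mirrored l (inj₂ (≤-trans h (+-monoʳ-≤ p' (S-mono (n≤1+n m))))) } }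

  answer-copy : ∀ {m q} → m < n → q < P (suc m) → Linked F m q q
  answer-copy {m} {q} m<n q<P = record
    { rounds = m<n ; p<w₁ = in-prefix₁ m<n q<P ; p'<w₂ = in-prefix₂ m<n q<P
    ; same-letter = common-prefix q q<Pn ; copied = λ _ → refl
    ; mirrored = λ { (inj₁ h) → ⊥-elim (<⇒≱ q<Pn (near-end⇒after-prefix₁ (<⇒≤ m<n) h))
                   ; (inj₂ h) → ⊥-elim (<⇒≱ q<Pn (near-end⇒after-prefix₂ (<⇒≤ m<n) h)) } }
    where
    q<Pn : q < P n
    q<Pn = <-≤-trans q<P (P-mono m<n)

  answer-mirror : ∀ {m q} → m < n → q < N₁ → N₁ ≤ q + S (suc m)
    → ∃[ q' ] Mirrored N₁ N₂ q q' × Linked F m q q'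
  answer-mirror {m} {q} m<n q<N₁ near = q' , mq , record
    { rounds = m<n ; p<w₁ = q<N₁ ; p'<w₂ = q'<N₂
    ; same-letter = common-suffix q q' mq (≤-trans near (+-monoʳ-≤ q (S-mono m<n)))
    ; copied   = λ { (inj₁ h) → ⊥-elim (<⇒≱ (<-≤-trans h Pm≤Pn) (near-end⇒after-prefix₁ m<n near))
                   ; (inj₂ h) → ⊥-elim (<⇒≱ (<-≤-trans h Pm≤Pn)
                                          (near-end⇒after-prefix₂ m<n (mirrored-near-end mq near))) }
    ; mirrored = λ _ → mq }
    where
    Pm≤Pn : P m ≤ P n
    Pm≤Pn = P-mono (<⇒≤ m<n)
    N₁≤q+N₂ : N₁ ≤ q + N₂
    N₁≤q+N₂ = ≤-trans near (+-monoʳ-≤ q (≤-trans (S-mono m<n) (≤-trans (m≤n+m _ _) fits₂)))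
    q' : ℕ
    q' = q + N₂ ∸ N₁
    mq : Mirrored N₁ N₂ q q'
    mq = mirror (sym (m∸n+n≡m N₁≤q+N₂))
    q'<N₂ : q' < N₂
    q'<N₂ = +-cancelʳ-< N₁ q' N₂
      (subst₂ _<_ (Mirrored.balance mq) (+-comm N₁ N₂) (+-monoˡ-< N₂ q<N₁))

  answer-prefix-block : ∀ {m q} → m < n → q < N₁ → P (suc m) ≤ q → q + S (suc m) < N₁
    → ∃[ q' ] q' < P (suc m) × Linked F m q q'
  answer-prefix-block {m} {q} m<n q<N₁ P≤q far =
    let (a , wq≡a) = letterAt-just w₁ q<N₁
        (q' , Pm≤q' , q'<P , wq'≡a) = prefix-block₁ m m<n q a wq≡a
    in q' , q'<P , record
      { rounds = m<n ; p<w₁ = q<N₁ ; p'<w₂ = in-prefix₂ m<n q'<P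
      ; same-letter = trans wq≡a (sym wq'≡a)
      ; copied   = λ { (inj₁ h) → ⊥-elim (<⇒≱ h (≤-trans (P-mono (n≤1+n m)) P≤q))
                     ; (inj₂ h) → ⊥-elim (<⇒≱ h Pm≤q') }
      ; mirrored = λ { (inj₁ h) → ⊥-elim (<⇒≱ far (≤-trans h (+-monoʳ-≤ q (S-mono (n≤1+n m)))))
                     ; (inj₂ h) → ⊥-elim (<⇒≱ (<-≤-trans q'<P (P-mono m<n))
                                            (near-end⇒after-prefix₂ (≤-trans (n≤1+n m) m<n) h)) } }

  answer-suffix-block : ∀ {m q} → m < n → q < N₁ → P (suc m) ≤ q → q + S (suc m) < N₁
    → ∃[ q' ] N₂ ≤ q' + S (suc m) × Linked F m q q'
  answer-suffix-block {m} {q} m<n q<N₁ P≤q far =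
    let (a , wq≡a) = letterAt-just w₁ q<N₁
        (q' , q'+S<N₂ , N₂≤q'+S , wq'≡a) = suffix-block₁ m m<n q a wq≡a
    in q' , N₂≤q'+S , record
      { rounds = m<n ; p<w₁ = q<N₁ ; p'<w₂ = ≤-<-trans (m≤m+n q' _) q'+S<N₂
      ; same-letter = trans wq≡a (sym wq'≡a)
      ; copied   = λ { (inj₁ h) → ⊥-elim (<⇒≱ h (≤-trans (P-mono (n≤1+n m)) P≤q))
                     ; (inj₂ h) → ⊥-elim (<⇒≱ (<-≤-trans h (P-mono (<⇒≤ m<n)))
                                            (near-end⇒after-prefix₂ m<n N₂≤q'+S)) }
      ; mirrored = λ { (inj₁ h) → ⊥-elim (<⇒≱ far (≤-trans h (+-monoʳ-≤ q (S-mono (n≤1+n m)))))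
                     ; (inj₂ h) → ⊥-elim (<⇒≱ q'+S<N₂ h) } }

  copied-below : ∀ {m p p' t} → Linked F (suc m) p p' → t < P (suc m) → t < p → t < p'
  copied-below {m} {p' = p'} l t<P t<p with p' <? P (suc m)
  ... | yes p'<P = subst (_ <_) (copied l (inj₂ p'<P)) t<p
  ... | no  p'≮P = <-≤-trans t<P (≮⇒≥ p'≮P)

  copied-above : ∀ {m p p' t} → Linked F (suc m) p p' → p < t → t < P (suc m) → p' < t
  copied-above l p<t t<P = subst (_< _) (copied l (inj₁ (<-trans p<t t<P))) p<t

  mirrored-above : ∀ {m p p' t'} → Linked F (suc m) p p' → N₂ ≤ t' + S (suc m) → p + N₂ < t' + N₁ → p' < t'
  mirrored-above {m} {p} {p'} {t'} l N₂≤t'+S p+N₂<t'+N₁ with N₂ ≤? p' + S (suc m)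
  ... | yes near = +-cancelʳ-< N₁ p' t'
                     (subst (_< t' + N₁) (Mirrored.balance (mirrored l (inj₂ near))) p+N₂<t'+N₁)
  ... | no  far  = +-cancelʳ-< (S (suc m)) p' t' (<-≤-trans (≰⇒> far) N₂≤t'+S)

  Answer : ℕ → ℕ → ℕ → ℕ → Set
  Answer m p p' q = ∃[ q' ] q' < N₂ × order q p ≡ order q' p' × Linked F m q q'

  forth-left : ∀ {m p p' q} → Linked F (suc m) p p' → q < p → q < N₁ → Answer m p p' q
  forth-left {m} {q = q} l q<p q<N₁ with q <? P (suc m)
  ... | yes q<P = q , p'<w₂ (answer-copy (fewer l) q<P)
                    , same-order-< q<p (copied-below l q<P q<p) , answer-copy (fewer l) q<P
  ... | no q≮P with N₁ ≤? q + S (suc m)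
  ...   | yes near =
    let (q' , mq , l') = answer-mirror (fewer l) q<N₁ near
        mp = mirrored l (inj₁ (≤-trans near (+-monoˡ-≤ _ (<⇒≤ q<p))))
    in q' , p'<w₂ l' , same-order-< q<p (mirrored-< mp mq q<p) , l'
  ...   | no far =
    let (q' , q'<P , l') = answer-prefix-block (fewer l) q<N₁ (≮⇒≥ q≮P) (≰⇒> far)
    in q' , p'<w₂ l'
     , same-order-< q<p (copied-below l q'<P (<-trans (<-≤-trans q'<P (≮⇒≥ q≮P)) q<p)) , l'

  forth-right : ∀ {m p p' q} → Linked F (suc m) p p' → p < q → q < N₁ → Answer m p p' q
  forth-right {m} {p} {q = q} l p<q q<N₁ with q <? P (suc m)
  ... | yes q<P = q , p'<w₂ (answer-copy (fewer l) q<P)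
                    , same-order-> p<q (copied-above l p<q q<P) , answer-copy (fewer l) q<P
  ... | no q≮P with N₁ ≤? q + S (suc m)
  ...   | yes near =
    let (q' , mq , l') = answer-mirror (fewer l) q<N₁ near
        p+N₂<q'+N₁ = subst (p + N₂ <_) (Mirrored.balance mq) (+-monoˡ-< N₂ p<q)
    in q' , p'<w₂ l' , same-order-> p<q (mirrored-above l (mirrored-near-end mq near) p+N₂<q'+N₁) , l'
  ...   | no far =
    let (q' , N₂≤q'+S , l') = answer-suffix-block (fewer l) q<N₁ (≮⇒≥ q≮P) (≰⇒> far)
        p+S<N₁ = <-trans (+-monoˡ-< (S (suc m)) p<q) (≰⇒> far)
    in q' , p'<w₂ l' , same-order-> p<q (mirrored-above l N₂≤q'+S (far-before-near p+S<N₁ N₂≤q'+S)) , l'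

  forth : ∀ {m p p'} → Linked F (suc m) p p' → ∀ q → q < N₁ → Answer m p p' q
  forth {p = p} {p'} l q q<N₁ with <-cmp q p
  ... | tri< q<p _ _ = forth-left l q<p q<N₁
  ... | tri≈ _ refl _ = p' , p'<w₂ l , trans (order-refl q) (sym (order-refl p')) , linked-suc l
  ... | tri> _ _ p<q = forth-right l p<q q<N₁

  start : ∀ {m} → m < n → ∀ q → q < N₁ → ∃[ q' ] q' < N₂ × Linked F m q q'
  start {m} m<n q q<N₁ with q <? P (suc m)
  ... | yes q<P = q , p'<w₂ (answer-copy m<n q<P) , answer-copy m<n q<P
  ... | no q≮P with N₁ ≤? q + S (suc m)
  ...   | yes near = let (q' , _ , l) = answer-mirror m<n q<N₁ near in q' , p'<w₂ l , l
  ...   | no far   = let (q' , _ , l) = answer-prefix-block m<n q<N₁ (≮⇒≥ q≮P) (≰⇒> far)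
                     in q' , p'<w₂ l , l

frame-≅ : ∀ {n} {w₁ w₂ : List A} → Frame w₁ w₂ n → w₁ ≅[ n ] w₂
frame-≅ {n = zero}  F = tt
frame-≅ {n = suc m} F =
  Strategy.wins (Linked F) Linked.same-letter Forward.forth back m (Forward.start ≤-refl) start-back
  where
  module Forward  = Deletion F
  module Backward = Deletion (frame-swap F)
  back : ∀ {r p p'} → Linked F (suc r) p p' → ∀ q' → q' < _
    → ∃[ q ] q < _ × order q p ≡ order q' p' × Linked F r q q'
  back l q' q'<w₂ =
    let (q , q<w₁ , o , l') = Backward.forth (linked-swap l) q' q'<w₂ in q , q<w₁ , sym o , linked-unswap l'
  start-back : ∀ q' → q' < _ → ∃[ q ] q < _ × Linked F m q q'
  start-back q' q'<w₂ = let (q , q<w₁ , l) = Backward.start ≤-refl q' q'<w₂ in q , q<w₁ , linked-unswap l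

letterAt-∈ : ∀ (w : List A) {i a} → letterAt w i ≡ just a → a ∈ w
letterAt-∈ (c ∷ w) {zero}  refl = here refl
letterAt-∈ (c ∷ w) {suc i} e    = there (letterAt-∈ w e)

∈-letterAt : ∀ (w : List A) {a} → a ∈ w → ∃[ i ] i < length w × letterAt w i ≡ just a
∈-letterAt (c ∷ w) (here refl) = zero , s≤s z≤n , refl
∈-letterAt (c ∷ w) (there a∈w) = let (i , i<w , e) = ∈-letterAt w a∈w in suc i , s≤s i<w , e

-- Blocks of a suffix are listed from the right end of the word.
concatʳ : List (List A) → List A
concatʳ []       = []
concatʳ (D ∷ Ds) = concatʳ Ds ++ D

prefix-length : List (List A) → ℕ → ℕ
prefix-length Bs       zero    = 0
prefix-length []       (suc m) = 0
prefix-length (B ∷ Bs) (suc m) = length B + prefix-length Bs m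

prefix-length-mono : ∀ (Bs : List (List A)) {a b} → a ≤ b → prefix-length Bs a ≤ prefix-length Bs b
prefix-length-mono Bs       z≤n     = z≤n
prefix-length-mono []       (s≤s _) = z≤n
prefix-length-mono (B ∷ Bs) (s≤s a≤b) = +-monoʳ-≤ (length B) (prefix-length-mono Bs a≤b)

prefix-length-≤ : ∀ (Bs : List (List A)) m → prefix-length Bs m ≤ length (concat Bs)
prefix-length-≤ Bs       zero    = z≤n
prefix-length-≤ []       (suc m) = z≤n
prefix-length-≤ (B ∷ Bs) (suc m) rewrite length-++ B {concat Bs} = +-monoʳ-≤ (length B) (prefix-length-≤ Bs m)

prefix-length-≤ʳ : ∀ (Ds : List (List A)) m → prefix-length Ds m ≤ length (concatʳ Ds)
prefix-length-≤ʳ Ds       zero    = z≤n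
prefix-length-≤ʳ []       (suc m) = z≤n
prefix-length-≤ʳ (D ∷ Ds) (suc m) rewrite length-++ (concatʳ Ds) {D} | +-comm (length (concatʳ Ds)) (length D) =
  +-monoʳ-≤ (length D) (prefix-length-≤ʳ Ds m)

in-block : ∀ {a} (Bs : List (List A)) m → m < length Bs → All (a ∈_) Bs
  → ∃[ q ] prefix-length Bs m ≤ q × q < prefix-length Bs (suc m) × letterAt (concat Bs) q ≡ just a
in-block (B ∷ Bs) zero _ (a∈B ∷ _) =
  let (i , i<B , e) = ∈-letterAt B a∈B
  in i , z≤n , subst (i <_) (sym (+-identityʳ _)) i<B , trans (letterAt-++ˡ B (concat Bs) i<B) e
in-block (B ∷ Bs) (suc m) (s≤s m<Bs) (_ ∷ a∈Bs) =
  let (q , lower , upper , e) = in-block Bs m m<Bs a∈Bs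
  in length B + q , +-monoʳ-≤ (length B) lower , +-monoʳ-< (length B) upper , trans (letterAt-++ʳ B (concat Bs) q) e

in-blockʳ : ∀ {a} (Ds : List (List A)) m → m < length Ds → All (a ∈_) Ds
  → ∃[ t ] t + prefix-length Ds m < length (concatʳ Ds)
         × length (concatʳ Ds) ≤ t + prefix-length Ds (suc m) × letterAt (concatʳ Ds) t ≡ just a
in-blockʳ (D ∷ Ds) zero _ (a∈D ∷ _) rewrite length-++ (concatʳ Ds) {D} =
  let (i , i<D , e) = ∈-letterAt D a∈D
  in length (concatʳ Ds) + i
   , subst (_< length (concatʳ Ds) + length D) (sym (+-identityʳ _)) (+-monoʳ-< (length (concatʳ Ds)) i<D)
   , subst (length (concatʳ Ds) + length D ≤_) (rearrange (length (concatʳ Ds)) i (length D))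
       (+-monoʳ-≤ (length (concatʳ Ds)) (m≤n+m (length D) i))
   , trans (letterAt-++ʳ (concatʳ Ds) D i) e
  where
  rearrange : ∀ c i d → c + (i + d) ≡ c + i + (d + 0)
  rearrange = solve-∀
in-blockʳ (D ∷ Ds) (suc m) (s≤s m<Ds) (_ ∷ a∈Ds) rewrite length-++ (concatʳ Ds) {D} =
  let (t , lower , upper , e) = in-blockʳ Ds m m<Ds a∈Ds
  in t
   , subst (_< length (concatʳ Ds) + length D) (rearrange t (length D) _) (+-monoˡ-< (length D) lower)
   , subst (length (concatʳ Ds) + length D ≤_) (rearrange t (length D) _) (+-monoˡ-≤ (length D) upper)
   , trans (letterAt-++ˡ (concatʳ Ds) D (≤-<-trans (m≤m+n t _) lower)) e
  where
  rearrange : ∀ t d s → t + s + d ≡ t + (d + s)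
  rearrange = solve-∀

mirrored-offset : ∀ {a₁ a₂ v p p'} → Mirrored (a₁ + v) (a₂ + v) p p' → a₁ ≤ p
  → ∃[ t ] p ≡ a₁ + t × p' ≡ a₂ + t
mirrored-offset {a₁} {a₂} {v} {p} {p'} (mirror balance) a₁≤p = p ∸ a₁ , sym p≡a₁+t , p'≡a₂+t
  where
  open ≡-Reasoning
  t = p ∸ a₁
  p≡a₁+t : a₁ + t ≡ p
  p≡a₁+t = m+[n∸m]≡n a₁≤p
  p'≡a₂+t : p' ≡ a₂ + t
  p'≡a₂+t = +-cancelʳ-≡ (a₁ + v) p' (a₂ + t) (begin
    p' + (a₁ + v)        ≡⟨ sym balance ⟩
    p + (a₂ + v)         ≡⟨ cong (_+ (a₂ + v)) (sym p≡a₁+t) ⟩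
    (a₁ + t) + (a₂ + v)  ≡⟨ rearrange a₁ t a₂ v ⟩
    (a₂ + t) + (a₁ + v)  ∎)
    where
    rearrange : ∀ a₁ t a₂ v → (a₁ + t) + (a₂ + v) ≡ (a₂ + t) + (a₁ + v)
    rearrange = solve-∀

module BlockFrame {L : List A} {n} (Bs Ds : List (List A))
  (n≤Bs : n ≤ length Bs) (n≤Ds : n ≤ length Ds)
  (Bs-full : All (L ⊆_) Bs) (Ds-full : All (L ⊆_) Ds) where

  U V : List A
  U = concat Bs
  V = concatʳ Ds

  framed : List A → List A
  framed Z = (U ++ Z) ++ V

  length-framed : ∀ Z → length (framed Z) ≡ length (U ++ Z) + length V
  length-framed Z = length-++ (U ++ Z)

  fits : ∀ Z → prefix-length Bs n + prefix-length Ds n ≤ length (framed Z)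
  fits Z = subst (_ ≤_) (sym (length-framed Z))
    (+-mono-≤ (≤-trans (prefix-length-≤ Bs n) (subst (_ ≤_) (sym (length-++ U)) (m≤m+n _ _)))
              (prefix-length-≤ʳ Ds n))

  prefix-letter : ∀ Z {p} → p < length U → letterAt (framed Z) p ≡ letterAt U p
  prefix-letter Z p<U = trans (letterAt-++ˡ (U ++ Z) V (<-++ˡ U Z p<U)) (letterAt-++ˡ U Z p<U)

  suffix-offset : ∀ X Y {p p'} → Mirrored (length (framed X)) (length (framed Y)) p p'
    → length (framed X) ≤ p + prefix-length Ds n → ∃[ t ] p ≡ length (U ++ X) + t × p' ≡ length (U ++ Y) + t
  suffix-offset X Y {p} mp near = mirrored-offset mp′ UX≤p
    where
    mp′ = subst₂ (λ N N' → Mirrored N N' _ _) (length-framed X) (length-framed Y) mp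
    UX≤p : length (U ++ X) ≤ p
    UX≤p = +-cancelʳ-≤ (length V) _ p
      (≤-trans (subst (_≤ p + prefix-length Ds n) (length-framed X) near) (+-monoʳ-≤ p (prefix-length-≤ʳ Ds n)))

  common-suffix : ∀ X Y p p' → Mirrored (length (framed X)) (length (framed Y)) p p'
    → length (framed X) ≤ p + prefix-length Ds n → letterAt (framed X) p ≡ letterAt (framed Y) p'
  common-suffix X Y p p' mp near with suffix-offset X Y mp near
  ... | t , refl , refl = trans (letterAt-++ʳ (U ++ X) V t) (sym (letterAt-++ʳ (U ++ Y) V t))

  prefix-block : ∀ Z Z' m → m < n → All (_∈ L) (framed Z) → ∀ q a → letterAt (framed Z) q ≡ just a
    → ∃[ q' ] prefix-length Bs m ≤ q' × q' < prefix-length Bs (suc m) × letterAt (framed Z') q' ≡ just a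
  prefix-block Z Z' m m<n over-L q a e =
    let a∈L = All.lookup over-L (letterAt-∈ (framed Z) e)
        (q' , lower , upper , e') = in-block Bs m (<-≤-trans m<n n≤Bs) (All.map (λ L⊆B → L⊆B a∈L) Bs-full)
    in q' , lower , upper
     , trans (prefix-letter Z' (<-≤-trans upper (prefix-length-≤ Bs (suc m)))) e'

  suffix-block : ∀ Z Z' m → m < n → All (_∈ L) (framed Z) → ∀ q a → letterAt (framed Z) q ≡ just a
    → ∃[ q' ] q' + prefix-length Ds m < length (framed Z')
            × length (framed Z') ≤ q' + prefix-length Ds (suc m) × letterAt (framed Z') q' ≡ just a
  suffix-block Z Z' m m<n over-L q a e =
    let a∈L = All.lookup over-L (letterAt-∈ (framed Z) e)
        (t , lower , upper , e') = in-blockʳ Ds m (<-≤-trans m<n n≤Ds) (All.map (λ L⊆D → L⊆D a∈L) Ds-full)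
        c = length (U ++ Z')
    in c + t
     , subst₂ _<_ (sym (+-assoc c t _)) (sym (length-framed Z')) (+-monoʳ-< c lower)
     , subst₂ _≤_ (sym (length-framed Z')) (sym (+-assoc c t _)) (+-monoʳ-≤ c upper)
     , trans (letterAt-++ʳ (U ++ Z') V t) e'

  frame : ∀ X Y → All (_∈ L) (framed X) → All (_∈ L) (framed Y) → Frame (framed X) (framed Y) n
  frame X Y X-over-L Y-over-L = record
    { P = prefix-length Bs ; S = prefix-length Ds
    ; P-mono = prefix-length-mono Bs ; S-mono = prefix-length-mono Ds
    ; fits₁ = fits X ; fits₂ = fits Y
    ; common-prefix = λ p p<P → let p<U = <-≤-trans p<P (prefix-length-≤ Bs n)
                                in trans (prefix-letter X p<U) (sym (prefix-letter Y p<U))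
    ; common-suffix = common-suffix X Y
    ; prefix-block₁ = λ m m<n → prefix-block X Y m m<n X-over-L
    ; prefix-block₂ = λ m m<n → prefix-block Y X m m<n Y-over-L
    ; suffix-block₁ = λ m m<n → suffix-block X Y m m<n X-over-L
    ; suffix-block₂ = λ m m<n → suffix-block Y X m m<n Y-over-L }

concatʳ-∷ʳ : ∀ (Ds : List (List A)) D → concatʳ (Ds ∷ʳ D) ≡ D ++ concatʳ Ds
concatʳ-∷ʳ []        D = sym (++-identityʳ D)
concatʳ-∷ʳ (D′ ∷ Ds) D = trans (cong (_++ D′) (concatʳ-∷ʳ Ds D)) (++-assoc D (concatʳ Ds) D′)

concatʳ-reverse : ∀ (Ds : List (List A)) → concatʳ (reverse Ds) ≡ concat Ds
concatʳ-reverse []       = refl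
concatʳ-reverse (D ∷ Ds) = begin
  concatʳ (reverse (D ∷ Ds))   ≡⟨ cong concatʳ (unfold-reverse D Ds) ⟩
  concatʳ (reverse Ds ∷ʳ D)    ≡⟨ concatʳ-∷ʳ (reverse Ds) D ⟩
  D ++ concatʳ (reverse Ds)    ≡⟨ cong (D ++_) (concatʳ-reverse Ds) ⟩
  D ++ concat Ds               ∎
  where open ≡-Reasoning

All-reverse : ∀ {P : A → Set} {xs} → All P xs → All P (reverse xs)
All-reverse Pxs = All.tabulate (λ x∈ → All.lookup Pxs (Anyₚ.reverse⁻ x∈))

split-ends : ∀ n (xs : List A) → n + n ≤ length xs
  → ∃[ ys ] ∃[ zs ] ∃[ ws ] xs ≡ ys ++ zs ++ ws × length ys ≡ n × length ws ≡ n
split-ends n xs 2n≤xs = take n xs , take r rest , drop r rest , xs≡ , length-take′ , length-drop′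
  where
  rest = drop n xs
  r = length rest ∸ n
  n≤rest : n ≤ length rest
  n≤rest = subst (n ≤_) (sym (length-drop n xs)) (m+n≤o⇒m≤o∸n n 2n≤xs)
  xs≡ : xs ≡ take n xs ++ take r rest ++ drop r rest
  xs≡ = sym (trans (cong (take n xs ++_) (take++drop≡id r rest)) (take++drop≡id n xs))
  length-take′ : length (take n xs) ≡ n
  length-take′ = trans (length-take n xs) (m≤n⇒m⊓n≡m (m+n≤o⇒m≤o n 2n≤xs))
  length-drop′ : length (drop r rest) ≡ n
  length-drop′ = trans (length-drop r rest) (m∸[m∸n]≡n n≤rest)

-- Turns the bound (4n)^k into the shape C · n^k.
^-distrib-* : ∀ a b l → (a * b) ^ l ≡ a ^ l * b ^ l
^-distrib-* a b zero    = refl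
^-distrib-* a b (suc l) = trans (cong (a * b *_) (^-distrib-* a b l)) (interchange a b (a ^ l) (b ^ l))
  where
  interchange : ∀ a b c d → a * b * (c * d) ≡ a * c * (b * d)
  interchange = solve-∀

module Alphabet {A : Set} (_≟_ : DecidableEquality A) where

  _∖_ : List A → A → List A
  L ∖ a = filter (λ e → ¬? (e ≟ a)) L

  ∈-∖ : ∀ {L a e} → e ∈ L → ¬ e ≡ a → e ∈ L ∖ a
  ∈-∖ {a = a} = ∈-filter⁺ (λ e → ¬? (e ≟ a))

  ∖-∈ : ∀ {L a e} → e ∈ L ∖ a → e ∈ L × ¬ e ≡ a
  ∖-∈ {a = a} = ∈-filter⁻ (λ e → ¬? (e ≟ a))

  ∖-shorter : ∀ {L a} → a ∈ L → length (L ∖ a) < length L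
  ∖-shorter {L} {a} a∈L = filter-notAll (λ e → ¬? (e ≟ a)) L (Any.map (λ a≡e e≢a → e≢a (sym a≡e)) a∈L)

  over-∖ : ∀ {L a} {w : List A} → All (_∈ L) w → a ∉ w → All (_∈ L ∖ a) w
  over-∖ w-over-L a∉w = All.tabulate λ e∈w → ∈-∖ (All.lookup w-over-L e∈w) (λ e≡a → a∉w (subst (_∈ _) e≡a e∈w))

  Full : List A → List A × A → Set
  Full L (x , a) = a ∉ x × L ⊆ x ∷ʳ a × All (_∈ L) (x ∷ʳ a)

  block-word : List A × A → List A
  block-word (x , a) = x ∷ʳ a

  blocks-word : List (List A × A) → List A
  blocks-word Ts = concat (map block-word Ts)

  blocks-word-++ : ∀ Ts Ts′ → blocks-word (Ts ++ Ts′) ≡ blocks-word Ts ++ blocks-word Ts′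
  blocks-word-++ Ts Ts′ = trans (cong concat (map-++ block-word Ts Ts′)) (sym (concat-++ (map block-word Ts) _))

  blocks-over : ∀ {L} Ts → All (Full L) Ts → All (_∈ L) (blocks-word Ts)
  blocks-over Ts full = Allₚ.concat⁺ (Allₚ.map⁺ (All.map (proj₂ ∘ proj₂) full))

  blocks-cover : ∀ {L} Ts → All (Full L) Ts → All (L ⊆_) (map block-word Ts)
  blocks-cover Ts full = Allₚ.map⁺ (All.map (proj₁ ∘ proj₂) full)

  first-block : ∀ L → (∃[ c ] c ∈ L) → ∀ w
    → (∃[ b ] b ∈ L × b ∉ w)
    ⊎ (∃[ x ] ∃[ a ] ∃[ y ] w ≡ x ++ a ∷ y × a ∈ L × a ∉ x × L ⊆ x ∷ʳ a)
  first-block L (c , c∈L) [] = inj₁ (c , c∈L , λ ())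
  first-block L (d , d∈L) (c ∷ w) with L ∖ c in L∖c≡
  ... | [] = inj₂ ([] , c , w , refl , subst (_∈ L) (only-c d∈L) d∈L , (λ ()) , λ e∈L → here (only-c e∈L))
    where
    only-c : ∀ {e} → e ∈ L → e ≡ c
    only-c {e} e∈L with e ≟ c
    ... | yes e≡c = e≡c
    ... | no  e≢c with subst (e ∈_) L∖c≡ (∈-∖ e∈L e≢c)
    ...   | ()
  ... | d′ ∷ _ with first-block (L ∖ c) (d′ , subst (d′ ∈_) (sym L∖c≡) (here refl)) w
  ...   | inj₁ (b , b∈L∖c , b∉w) =
    let (b∈L , b≢c) = ∖-∈ b∈L∖c in inj₁ (b , b∈L , λ { (here b≡c) → b≢c b≡c ; (there b∈w) → b∉w b∈w })
  ...   | inj₂ (x , a , y , refl , a∈L∖c , a∉x , covers) =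
    let (a∈L , a≢c) = ∖-∈ a∈L∖c
    in inj₂ (c ∷ x , a , y , refl , a∈L , (λ { (here a≡c) → a≢c a≡c ; (there a∈x) → a∉x a∈x }) , covers′)
    where
    covers′ : L ⊆ c ∷ x ∷ʳ a
    covers′ {e} e∈L with e ≟ c
    ... | yes refl = here refl
    ... | no  e≢c  = there (covers (∈-∖ e∈L e≢c))

  record Decomposition (L w : List A) : Set where
    field
      blocks  : List (List A × A)
      rest    : List A
      full    : All (Full L) blocks
      missing : A
      missing∈L    : missing ∈ L
      missing∉rest : missing ∉ rest
      splits  : w ≡ blocks-word blocks ++ rest

  decompose : ∀ L → (∃[ c ] c ∈ L) → ∀ w → Acc _<_ (length w) → All (_∈ L) w → Decomposition L w
  decompose L c∈L w (acc shorter) w-over-L with first-block L c∈L w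
  ... | inj₁ (b , b∈L , b∉w) = record
    { blocks = [] ; rest = w ; full = [] ; missing = b ; missing∈L = b∈L ; missing∉rest = b∉w ; splits = refl }
  ... | inj₂ (x , a , y , refl , a∈L , a∉x , covers) = record
    { blocks = (x , a) ∷ blocks ; rest = rest ; full = (a∉x , covers , block-over-L) ∷ full
    ; missing = missing ; missing∈L = missing∈L ; missing∉rest = missing∉rest
    ; splits = begin
        x ++ a ∷ y                                  ≡⟨ cong (λ z → x ++ a ∷ z) splits ⟩
        x ++ a ∷ (blocks-word blocks ++ rest)       ≡⟨ sym (++-assoc x (a ∷ []) _) ⟩
        (x ∷ʳ a) ++ (blocks-word blocks ++ rest)    ≡⟨ sym (++-assoc (x ∷ʳ a) _ rest) ⟩
        ((x ∷ʳ a) ++ blocks-word blocks) ++ rest    ∎ }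
    where
    open ≡-Reasoning
    y<w : length y < length (x ++ a ∷ y)
    y<w = subst (length y <_) (sym (length-++ x)) (m≤n+m (suc (length y)) (length x))
    block-over-L : All (_∈ L) (x ∷ʳ a)
    block-over-L = Allₚ.++⁺ (Allₚ.++⁻ˡ x w-over-L) (a∈L ∷ [])
    open Decomposition (decompose L c∈L y (shorter y<w) (All.tail (Allₚ.++⁻ʳ x w-over-L)))

  delete-middle : ∀ n {L} T₁ T₂ T₃ → length T₁ ≡ n → length T₃ ≡ n → All (Full L) (T₁ ++ T₂ ++ T₃)
    → blocks-word (T₁ ++ T₂ ++ T₃) ≅[ n ] blocks-word (T₁ ++ T₃)
  delete-middle n {L} T₁ T₂ T₃ |T₁| |T₃| full =
    subst₂ _≅[ n ]_ with-middle without-middle (frame-≅ (BF.frame M [] M-over-L ε-over-L))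
    where
    open ≡-Reasoning
    full₁ = Allₚ.++⁻ˡ T₁ full
    full₃ = Allₚ.++⁻ʳ T₂ (Allₚ.++⁻ʳ T₁ full)
    Ds = reverse (map block-word T₃)
    n≤Bs : n ≤ length (map block-word T₁)
    n≤Bs = ≤-reflexive (sym (trans (length-map block-word T₁) |T₁|))
    n≤Ds : n ≤ length Ds
    n≤Ds = ≤-reflexive (sym (trans (length-reverse (map block-word T₃)) (trans (length-map block-word T₃) |T₃|)))
    module BF = BlockFrame {L = L} (map block-word T₁) Ds n≤Bs n≤Ds
                  (blocks-cover T₁ full₁) (All-reverse (blocks-cover T₃ full₃))
    U M V : List A
    U = blocks-word T₁
    M = blocks-word T₂
    V = blocks-word T₃
    with-middle : BF.framed M ≡ blocks-word (T₁ ++ T₂ ++ T₃)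
    with-middle = begin
      (U ++ M) ++ concatʳ Ds         ≡⟨ cong ((U ++ M) ++_) (concatʳ-reverse (map block-word T₃)) ⟩
      (U ++ M) ++ V                  ≡⟨ ++-assoc U M V ⟩
      U ++ (M ++ V)                  ≡⟨ cong (U ++_) (sym (blocks-word-++ T₂ T₃)) ⟩
      U ++ blocks-word (T₂ ++ T₃)    ≡⟨ sym (blocks-word-++ T₁ (T₂ ++ T₃)) ⟩
      blocks-word (T₁ ++ T₂ ++ T₃)   ∎
    without-middle : BF.framed [] ≡ blocks-word (T₁ ++ T₃)
    without-middle = begin
      (U ++ []) ++ concatʳ Ds        ≡⟨ cong₂ _++_ (++-identityʳ U) (concatʳ-reverse (map block-word T₃)) ⟩
      U ++ V                         ≡⟨ sym (blocks-word-++ T₁ T₃) ⟩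
      blocks-word (T₁ ++ T₃)         ∎
    M-over-L : All (_∈ L) (BF.framed M)
    M-over-L = subst (All (_∈ L)) (sym with-middle) (blocks-over (T₁ ++ T₂ ++ T₃) full)
    ε-over-L : All (_∈ L) (BF.framed [])
    ε-over-L = subst (All (_∈ L)) (sym without-middle) (blocks-over (T₁ ++ T₃) (Allₚ.++⁺ full₁ full₃))

  cut-blocks : ∀ n {L} Ts → All (Full L) Ts
    → ∃[ Ts′ ] length Ts′ ≤ n + n × All (Full L) Ts′ × blocks-word Ts ≅[ n ] blocks-word Ts′
  cut-blocks n Ts full with length Ts ≤? n + n
  ... | yes short = Ts , short , full , ≅-refl n _
  ... | no  long with split-ends n Ts (<⇒≤ (≰⇒> long))
  ...   | T₁ , T₂ , T₃ , refl , |T₁| , |T₃| =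
    T₁ ++ T₃ , ≤-reflexive (trans (length-++ T₁) (cong₂ _+_ |T₁| |T₃|))
    , Allₚ.++⁺ (Allₚ.++⁻ˡ T₁ full) (Allₚ.++⁻ʳ T₂ (Allₚ.++⁻ʳ T₁ full))
    , delete-middle n T₁ T₂ T₃ |T₁| |T₃| full

  Small : ℕ → List A → ℕ → Set
  Small n L Q = ∀ w → All (_∈ L) w → ∃[ w′ ] w ≅[ n ] w′ × length w′ < Q

  -- If the smaller alphabets L ∖ a have small models, blocks over L can be
  -- shrunk one by one: each full block x a to x̂ a, and a given rest R to R̂.
  shrink-blocks : ∀ n {L Q} → (∀ a → a ∈ L → Small n (L ∖ a) Q)
    → ∀ Ts → All (Full L) Ts → ∀ {R R̂} → R ≅[ n ] R̂ → length R̂ < Q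
    → ∃[ ŵ ] (blocks-word Ts ++ R) ≅[ n ] ŵ × length ŵ < suc (length Ts) * Q
  shrink-blocks n {Q = Q} small [] [] {R̂ = R̂} R≅R̂ R̂<Q = R̂ , R≅R̂ , subst (_ <_) (sym (+-identityʳ Q)) R̂<Q
  shrink-blocks n {Q = Q} small ((x , a) ∷ Ts) ((a∉x , _ , block-over-L) ∷ full) {R} R≅R̂ R̂<Q =
    let a∈L = All.head (Allₚ.++⁻ʳ x block-over-L)
        (x̂ , x≅x̂ , x̂<Q) = small a a∈L x (over-∖ (Allₚ.++⁻ˡ x block-over-L) a∉x)
        (ŵ , rest≅ŵ , ŵ<) = shrink-blocks n small Ts full R≅R̂ R̂<Q
    in (x̂ ∷ʳ a) ++ ŵ
     , subst (_≅[ n ] ((x̂ ∷ʳ a) ++ ŵ)) (sym (++-assoc (x ∷ʳ a) (blocks-word Ts) R))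
         (≅-++ n (≅-++ n x≅x̂ (≅-refl n (a ∷ []))) rest≅ŵ)
     , subst (_< Q + suc (length Ts) * Q) (sym (length-block x̂ ŵ)) (+-mono-≤-< x̂<Q ŵ<)
    where
    length-block : ∀ x̂ ŵ → length ((x̂ ∷ʳ a) ++ ŵ) ≡ suc (length x̂) + length ŵ
    length-block x̂ ŵ = trans (length-++ (x̂ ∷ʳ a)) (cong (_+ length ŵ) (trans (length-++ x̂) (+-comm _ 1)))

  short-model : ∀ n → 1 ≤ n → ∀ l L → length L ≤ l → Small n L ((4 * n) ^ l)
  short-model n 1≤n l [] _ [] [] = [] , ≅-refl n [] , m^n>0 (4 * n) {{>-nonZero 4n>0}} l
    where
    4n>0 : 0 < 4 * n
    4n>0 = ≤-trans 1≤n (m≤m+n n _)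
  short-model n 1≤n (suc l) (c ∷ L) (s≤s |L|≤l) w w-over-L =
    let (Ts′ , Ts′≤2n , full′ , cut≅) = cut-blocks n blocks full
        (R̂ , rest≅R̂ , R̂<Q) = small missing missing∈L rest (over-∖ rest-over-L missing∉rest)
        (ŵ , shrunk≅ŵ , ŵ<) = shrink-blocks n small Ts′ full′ rest≅R̂ R̂<Q
    in ŵ , subst (_≅[ n ] ŵ) (sym splits) (≅-trans n (≅-++ n cut≅ (≅-refl n rest)) shrunk≅ŵ)
         , <-≤-trans ŵ< (*-monoˡ-≤ ((4 * n) ^ l) (≤-trans (s≤s Ts′≤2n) 2n+1≤4n))
    where
    open Decomposition (decompose (c ∷ L) (c , here refl) w (<-wellFounded (length w)) w-over-L)
    small : ∀ a → a ∈ c ∷ L → Small n ((c ∷ L) ∖ a) ((4 * n) ^ l)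
    small a a∈L = short-model n 1≤n l ((c ∷ L) ∖ a) (≤-pred (≤-trans (∖-shorter a∈L) (s≤s |L|≤l)))
    rest-over-L : All (_∈ c ∷ L) rest
    rest-over-L = Allₚ.++⁻ʳ (blocks-word blocks) (subst (All (_∈ c ∷ L)) splits w-over-L)
    2n+1≤4n : suc (n + n) ≤ 4 * n
    2n+1≤4n = ≤-trans (+-monoˡ-≤ (n + n) 1≤n) (+-monoʳ-≤ n (+-monoʳ-≤ n (m≤m+n n _)))

theorem6p2 : (k : ℕ) → 1 ≤ k →
    ∃ λ (C : ℕ) → ∃ λ (N : ℕ) → ∀ (n : ℕ) → N ≤ n →
    ∀ (φ : FO2 k) → qd φ ≤ n → Sentence φ →
    (∃ λ (w : List (Fin k)) → w ⊨ φ) →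
    ∃ λ (w : List (Fin k)) → (w ⊨ φ) × length w ≤ C * n ^ k
theorem6p2 k _ = 4 ^ k , 1 , λ n 1≤n φ qdφ≤n closed (w , w⊨φ) →
  let (w′ , w≅w′ , w′<4n^k) = short-model n 1≤n k (allFin k) (≤-reflexive (length-tabulate id)) w
                                (All.tabulate λ {a} _ → ∈-allFin a)
  in w′ , ≅-preserves-sentence n φ qdφ≤n closed w≅w′ w⊨φ
        , subst (length w′ ≤_) (^-distrib-* 4 n k) (<⇒≤ w′<4n^k)
  where open Alphabet _≟ᶠ_
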